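{- Let $S$ be a set with an up-directed binary relation $R$ (i.e. $(\forall a,b)(\exists c)\,Rac\,\&\,Rbc$). Let $S_u=\{x^{u}: x\subseteq S\}$ and define on $S_u$: $a\vee b=a\cup b$, $a\wedge b=(a\cap b)^{u}$, $\bot=\emptyset$, $\top=S^{u}$. Then $S_u$ contains $\bot$ and $\top$ and is closed under $\vee$, $\wedge$ and $a\mapsto a^{u}$, and for all $a,b,c\in S_u$: $a\vee a=a=a\vee\bot$; $a\wedge b=b\wedge a$; $a\vee b=b\vee a$; $a\vee(b\vee c)=(a\vee b)\vee c$; $(a\wedge a)\vee a=a\wedge a=a^{u}$; and if $a\vee b=b$ then $(a\wedge c)\vee(b\wedge c)=b\wedge c$.
   Context: $Rab$ means $(a,b)\in R$. For $x\in S$, $[x]=\{y: Ryx\}$, and for $A\subseteq S$, $A^{u}=\bigcup\{[x]: x\in S,\ [x]\cap A\neq\emptyset\}$ (upper approximation). -}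

module Defs where

open import Level using (0ℓ)
open import Data.Product using (Σ; ∃; _×_; _,_)
open import Relation.Unary using (Pred; _⊆_; _≐_; _∪_; _∩_; ∅; U)

UpDirected : {S : Set} → (S → S → Set) → Set
UpDirected {S} R = ∀ (a b : S) → ∃ λ c → R a c × R b c

module _ {S : Set} (R : S → S → Set) where

  -- [x] = { y : R y x }
  cls : S → Pred S 0ℓ
  cls x = λ y → R y x

  -- A^u = ⋃ { [x] : x ∈ S, [x] ∩ A ≠ ∅ }
  upper : Pred S 0ℓ → Pred S 0ℓ
  upper A = λ z → Σ S λ x → (Σ S λ y → cls x y × A y) × cls x z

  InSu : Pred S 0ℓ → Set₁
  InSu a = Σ (Pred S 0ℓ) λ X → a ≐ upper X

  _∨u_ : Pred S 0ℓ → Pred S 0ℓ → Pred S 0ℓ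
  a ∨u b = a ∪ b

  _∧u_ : Pred S 0ℓ → Pred S 0ℓ → Pred S 0ℓ
  a ∧u b = upper (a ∩ b)

  ⊥u : Pred S 0ℓ
  ⊥u = ∅

  ⊤u : Pred S 0ℓ
  ⊤u = upper U

module Submission where

-- The lattice-type laws then follow: ∨ laws from layer 1, a ∧ a = a^u from
-- monotonicity, (a ∧ a) ∨ a = a ∧ a from extensivity, and the last law from
-- a ∨ b = b ⇒ a ⊆ b ⇒ a ∧ c ⊆ b ∧ c.  These laws hold for arbitrary subsets, and directedness is used only through
-- its consequence that R is serial, for the law (a ∧ a) ∨ a = a ∧ a.

open import Defs
open import Level using (Level; 0ℓ)
open import Data.Product using (∃; _×_; _,_; proj₁; proj₂)
open import Data.Sum using (inj₁; inj₂; [_,_])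
open import Function using (id)
open import Relation.Unary using (Pred; _≐_; _⊆_; _∪_; _∩_; ∅; U)
open import Relation.Unary.Properties using (≐-refl; ≐-trans)

module SetAlgebra {ℓ : Level} {A : Set} where

  ∪-idem : (P : Pred A ℓ) → P ∪ P ≐ P
  ∪-idem P = [ id , id ] , inj₁

  ∪-identityʳ : (P : Pred A ℓ) → P ≐ P ∪ ∅
  ∪-identityʳ P = inj₁ , [ id , (λ ()) ]

  ∪-comm : (P Q : Pred A ℓ) → P ∪ Q ≐ Q ∪ P
  ∪-comm P Q = [ inj₂ , inj₁ ] , [ inj₂ , inj₁ ]

  ∪-assoc : (P Q T : Pred A ℓ) → P ∪ (Q ∪ T) ≐ (P ∪ Q) ∪ T
  ∪-assoc P Q T =
      [ (λ p → inj₁ (inj₁ p)) , [ (λ q → inj₁ (inj₂ q)) , inj₂ ] ]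
    , [ [ inj₁ , (λ q → inj₂ (inj₁ q)) ] , (λ t → inj₂ (inj₂ t)) ]

  ∪-absorbʳ : {P Q : Pred A ℓ} → Q ⊆ P → P ∪ Q ≐ P
  ∪-absorbʳ Q⊆P = [ id , Q⊆P ] , inj₁

  ∪-absorbˡ : {P Q : Pred A ℓ} → P ⊆ Q → P ∪ Q ≐ Q
  ∪-absorbˡ P⊆Q = [ P⊆Q , id ] , inj₂

  ∪-≐ʳ⇒⊆ : {P Q : Pred A ℓ} → P ∪ Q ≐ Q → P ⊆ Q
  ∪-≐ʳ⇒⊆ (P∪Q⊆Q , _) p = P∪Q⊆Q (inj₁ p)

  ∪-cong : {P P′ Q Q′ : Pred A ℓ} → P ≐ P′ → Q ≐ Q′ → P ∪ Q ≐ P′ ∪ Q′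
  ∪-cong (P⊆P′ , P′⊆P) (Q⊆Q′ , Q′⊆Q) =
      [ (λ p → inj₁ (P⊆P′ p)) , (λ q → inj₂ (Q⊆Q′ q)) ]
    , [ (λ p → inj₁ (P′⊆P p)) , (λ q → inj₂ (Q′⊆Q q)) ]

  ∩-comm : (P Q : Pred A ℓ) → P ∩ Q ⊆ Q ∩ P
  ∩-comm P Q (p , q) = q , p

open SetAlgebra

Serial : {S : Set} → (S → S → Set) → Set
Serial {S} R = ∀ (z : S) → ∃ λ c → R z c

upDirected⇒serial : {S : Set} {R : S → S → Set} → UpDirected R → Serial R
upDirected⇒serial dir z with dir z z
... | c , Rzc , _ = c , Rzc

module UpperApproximation {S : Set} (R : S → S → Set) where

  private
    _ᵘ : Pred S 0ℓ → Pred S 0ℓ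
    _ᵘ = upper R

  upper-mono : {A B : Pred S 0ℓ} → A ⊆ B → A ᵘ ⊆ B ᵘ
  upper-mono A⊆B (x , (y , Ryx , Ay) , Rzx) = x , (y , Ryx , A⊆B Ay) , Rzx

  upper-cong : {A B : Pred S 0ℓ} → A ≐ B → A ᵘ ≐ B ᵘ
  upper-cong (A⊆B , B⊆A) = upper-mono A⊆B , upper-mono B⊆A

  upper-∅ : ∅ ≐ ∅ ᵘ
  upper-∅ = (λ ()) , λ { (_ , (_ , _ , ()) , _) }

  upper-∪ : (A B : Pred S 0ℓ) → A ᵘ ∪ B ᵘ ≐ (A ∪ B) ᵘ
  upper-∪ A B = [ upper-mono inj₁ , upper-mono inj₂ ] , split
    where
    split : (A ∪ B) ᵘ ⊆ A ᵘ ∪ B ᵘ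
    split (x , (y , Ryx , inj₁ Ay) , Rzx) = inj₁ (x , (y , Ryx , Ay) , Rzx)
    split (x , (y , Ryx , inj₂ By) , Rzx) = inj₂ (x , (y , Ryx , By) , Rzx)

  -- If z R c for some c then z ∈ [c] and [c] meets A at z, so z ∈ A^u.
  upper-extensive : Serial R → (A : Pred S 0ℓ) → A ⊆ A ᵘ
  upper-extensive serial A {z} Az with serial z
  ... | c , Rzc = c , (z , Rzc , Az) , Rzc

  ∧u-monoˡ : {a b : Pred S 0ℓ} (c : Pred S 0ℓ) → a ⊆ b → _∧u_ R a c ⊆ _∧u_ R b c
  ∧u-monoˡ c a⊆b = upper-mono (λ { (a , c) → a⊆b a , c })

  ∧u-comm : (a b : Pred S 0ℓ) → _∧u_ R a b ≐ _∧u_ R b a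
  ∧u-comm a b = upper-mono (∩-comm a b) , upper-mono (∩-comm b a)

  ∧u-self : (a : Pred S 0ℓ) → _∧u_ R a a ≐ a ᵘ
  ∧u-self a = upper-cong (proj₁ , λ x → x , x)

  ∧u-extensive : Serial R → (a : Pred S 0ℓ) → a ⊆ _∧u_ R a a
  ∧u-extensive serial a z∈a = upper-extensive serial (a ∩ a) (z∈a , z∈a)

  upper-InSu : (X : Pred S 0ℓ) → InSu R (X ᵘ)
  upper-InSu X = X , ≐-refl

  ⊥u-InSu : InSu R (⊥u R)
  ⊥u-InSu = ∅ , upper-∅

  ∨u-InSu : (a b : Pred S 0ℓ) → InSu R a → InSu R b → InSu R (_∨u_ R a b)
  ∨u-InSu a b (X , a≐Xᵘ) (Y , b≐Yᵘ) = X ∪ Y , ≐-trans (∪-cong a≐Xᵘ b≐Yᵘ) (upper-∪ X Y)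

open UpperApproximation

mainTheorem2 : (S : Set) (R : S → S → Set) → UpDirected R →
    (InSu R (⊥u R) × InSu R (⊤u R)
    × (∀ (a b : Pred S 0ℓ) → InSu R a → InSu R b → InSu R (_∨u_ R a b))
    × (∀ (a b : Pred S 0ℓ) → InSu R a → InSu R b → InSu R (_∧u_ R a b))
    × (∀ (a : Pred S 0ℓ) → InSu R a → InSu R (upper R a)))
    × (∀ (a b c : Pred S 0ℓ) → InSu R a → InSu R b → InSu R c →
    (_∨u_ R a a ≐ a)
    × (a ≐ _∨u_ R a (⊥u R))
    × (_∧u_ R a b ≐ _∧u_ R b a)
    × (_∨u_ R a b ≐ _∨u_ R b a)
    × (_∨u_ R a (_∨u_ R b c) ≐ _∨u_ R (_∨u_ R a b) c)
    × (_∨u_ R (_∧u_ R a a) a ≐ _∧u_ R a a)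
    × (_∧u_ R a a ≐ upper R a)
    × (_∨u_ R a b ≐ b →
    _∨u_ R (_∧u_ R a c) (_∧u_ R b c) ≐ _∧u_ R b c))
mainTheorem2 S R directed =
    ( ⊥u-InSu R
    , upper-InSu R U
    , ∨u-InSu R
    , (λ a b _ _ → upper-InSu R (a ∩ b))
    , (λ a _ → upper-InSu R a) )
  , λ a b c _ _ _ →
    ( ∪-idem a
    , ∪-identityʳ a
    , ∧u-comm R a b
    , ∪-comm a b
    , ∪-assoc a b c
    , ∪-absorbʳ (∧u-extensive R (upDirected⇒serial directed) a)
    , ∧u-self R a
    , λ a∨b≐b → ∪-absorbˡ (∧u-monoˡ R c (∪-≐ʳ⇒⊆ a∨b≐b)) )
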